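{- Let $f(n), g(n) \in \mathbb{Z}[n]$ be nonzero polynomials with $\deg f < \deg g$ such that $$\lambda = \frac{f^3+g^3+1}{fg}$$ is a polynomial with integral coefficients. Put $a = 3(f^2+g^2-fg)-\lambda(f+g)$ and $P_{f,g}(X) = X^3 + a X^2 + \lambda X - 1$. Fix an integer $n$ for which $P_{f,g}$ (with $f,g,\lambda,a$ evaluated at $n$) is irreducible over $\mathbb{Q}$; its splitting field is a cyclic cubic field. Then for every root $\theta$ of $P_{f,g}$, the number $$G(\theta) = \frac{f\theta-1}{(f^2+g^2-fg)\theta-g}$$ is a root of $P_{f,g}$ different from $\theta$. Consequently the map $\theta \mapsto G(\theta)$ is the action on the roots of a generator of the Galois group $\mathbb{Z}/3\mathbb{Z}$.
   Context: All of $f,g,\lambda,a$ are evaluated at the fixed integer $n$ when $P_{f,g}$ is regarded as a polynomial with integer coefficients. -}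

module Defs where

open import Level using (Level; _⊔_) renaming (suc to lsuc)
open import Data.Nat as ℕ using (ℕ; _∸_)
open import Data.Integer as ℤ using (ℤ; +_; -[1+_])
import Data.Integer.Properties as ℤP
open import Data.Rational as ℚ using (ℚ)
import Data.Rational.Properties as ℚP
open import Data.List using (List; []; _∷_; length; map)
open import Data.Product using (Σ; _×_)
open import Data.Sum using (_⊎_)
open import Relation.Nullary using (¬_; yes; no)
open import Relation.Binary.Definitions using (DecidableEquality)
open import Relation.Binary.PropositionalEquality using (_≡_)
open import Algebra.Bundles using (CommutativeRing)

-- Univariate polynomials as coefficient lists (constant term first),
-- over a ring-like carrier with decidable equality.

module PolyOps {A : Set} (0# : A) (_+_ _*_ : A → A → A)
               (_≟_ : DecidableEquality A) where

  infixl 6 _+ₚ_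
  infixl 7 _*ₚ_
  infix 4 _≈ₚ_

  Poly : Set
  Poly = List A

  cons' : A → Poly → Poly
  cons' a [] with a ≟ 0#
  ... | yes _ = []
  ... | no  _ = a ∷ []
  cons' a (b ∷ bs) = a ∷ b ∷ bs

  trim : Poly → Poly
  trim [] = []
  trim (a ∷ p) = cons' a (trim p)

  _≈ₚ_ : Poly → Poly → Set
  p ≈ₚ q = trim p ≡ trim q

  NonZeroPoly : Poly → Set
  NonZeroPoly p = ¬ (trim p ≡ [])

  -- degree (the zero polynomial gets degree 0 by convention; it is only
  -- used for nonzero polynomials)
  deg : Poly → ℕ
  deg p = length (trim p) ∸ 1

  _+ₚ_ : Poly → Poly → Poly
  [] +ₚ q = q
  (a ∷ p) +ₚ [] = a ∷ p
  (a ∷ p) +ₚ (b ∷ q) = (a + b) ∷ (p +ₚ q)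

  scale : A → Poly → Poly
  scale c p = map (c *_) p

  _*ₚ_ : Poly → Poly → Poly
  [] *ₚ q = []
  (a ∷ p) *ₚ q = scale a q +ₚ (0# ∷ (p *ₚ q))

  eval : Poly → A → A
  eval [] x = 0#
  eval (a ∷ p) x = a + (x * eval p x)

  -- irreducibility over a field: nonconstant and every factorisation has
  -- a constant (i.e. unit, since p is nonzero) factor
  Irreducible : Poly → Set
  Irreducible p = NonZeroPoly p × (1 ℕ.≤ deg p) ×
    (∀ q r → p ≈ₚ (q *ₚ r) → (deg q ≡ 0) ⊎ (deg r ≡ 0))

module ℤ[X] = PolyOps (+ 0) ℤ._+_ ℤ._*_ ℤP._≟_
module ℚ[X] = PolyOps ℚ.0ℚ ℚ._+_ ℚ._*_ ℚP._≟_

record Field (c ℓ : Level) : Set (lsuc (c ⊔ ℓ)) where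
  field
    commutativeRing : CommutativeRing c ℓ
  open CommutativeRing commutativeRing public
  field
    1≉0     : ¬ (1# ≈ 0#)
    inverse : ∀ x → ¬ (x ≈ 0#) → Σ Carrier (λ y → (x * y) ≈ 1#)

module _ {c ℓ} (K : Field c ℓ) where
  open Field K

  ℕ↦K : ℕ → Carrier
  ℕ↦K ℕ.zero = 0#
  ℕ↦K (ℕ.suc n) = 1# + ℕ↦K n

  ι : ℤ → Carrier
  ι (+ n) = ℕ↦K n
  ι -[1+ n ] = - ℕ↦K (ℕ.suc n)

  CharZero : Set ℓ
  CharZero = ∀ m → ι m ≈ 0# → m ≡ + 0

toℚ : ℤ → ℚ
toℚ z = z ℚ./ 1

cubeSum : ℤ[X].Poly → ℤ[X].Poly → ℤ[X].Poly
cubeSum f g = (f *ₚ f *ₚ f) +ₚ ((g *ₚ g *ₚ g) +ₚ (+ 1 ∷ []))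
  where open ℤ[X]

aVal : ℤ → ℤ → ℤ → ℤ
aVal f g l = (+ 3 ℤ.* ((f ℤ.* f) ℤ.+ (g ℤ.* g) ℤ.- (f ℤ.* g))) ℤ.- (l ℤ.* (f ℤ.+ g))

Pℚ : ℤ → ℤ → ℤ → ℚ[X].Poly
Pℚ f g l = toℚ (ℤ.- + 1) ∷ toℚ l ∷ toℚ (aVal f g l) ∷ toℚ (+ 1) ∷ []

P-at : ∀ {c ℓ} (K : Field c ℓ) → ℤ → ℤ → ℤ → Field.Carrier K → Field.Carrier K
P-at K f g l θ = (θ * θ * θ) + (ι K (aVal f g l) * (θ * θ)) + (ι K l * θ) - 1#
  where open Field K

-- For a root θ of P = X³ + aX² + λX − 1 (f, g, λ, a evaluated at n, so that
-- fgλ = f³ + g³ + 1) in a field K of characteristic zero, with S = f² + g² − fg: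
--  * Sθ − g ≠ 0, since S ≠ 0 and P has no rational root;
--  * G(θ) is a root: for the homogenisation H(d, u) = d³P(u/d) of P,
--    (Sθ − g)³ P(G(θ)) = H(Sθ − g, fθ − 1), and an explicit polynomial identity
--    (root-certificate) writes the latter as a combination of P(θ) and
--    fgλ − (f³ + g³ + 1);
--  * G(θ) ≠ θ: a fixed point is a root of (Sθ − g)θ − (fθ − 1); eliminating with
--    P (fixed-point-certificate) gives αθ = β with α = −3(f − g)² ≠ 0 when f ≠ g,
--    a rational root; when f = g the cubic has the root 1.
-- Irreducibility is used only through rational-root-descent: αθ = β in K with
-- integers α ≠ 0, β makes β/α a rational root, because the integer α³P(β/α)
-- vanishes in K.

module Submission where

open import Defs
open import Level using (Level)
open import Data.Nat using (_<_)
open import Data.Integer as ℤ using (ℤ)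
open import Data.Product using (_×_)
open import Relation.Nullary using (¬_)

open import Data.Nat as ℕ using (ℕ)
import Data.Nat.Properties as ℕP
open import Data.Integer using (+_; -[1+_])
import Data.Integer.Properties as ℤP
import Data.Integer.Solver as ℤSolver
import Data.Integer.GCD as ℤGCD
open import Data.Sign as Sign using ()
open import Data.Product using (Σ; _,_)
open import Function using (_∘_)
open import Data.Maybe using (Maybe; just; nothing)
open import Data.Sum using (_⊎_; inj₁; inj₂; [_,_]′)
open import Data.List using ([]; _∷_)
open import Data.Rational as ℚ using (ℚ)
import Data.Rational.Properties as ℚP
import Data.Nat.Coprimality as Coprime
open import Relation.Nullary using (yes; no)
open import Relation.Binary.PropositionalEquality as ≡ using (_≡_)
open import Algebra.Bundles using (CommutativeRing)
import Algebra.Solver.Ring.AlmostCommutativeRing as ACR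
import Algebra.Solver.Ring as RingSolver
import Algebra.Properties.Ring as RingProperties
import Relation.Binary.Reasoning.Setoid as SetoidReasoning

-- Integer expressions: a syntax for integer polynomial expressions,
-- so that one lemma transports any of them along ι : ℤ → K.
data ℤExpr : Set where
  ‵_ : ℤ → ℤExpr
  _⊕_ _⊗_ _⊖_ : ℤExpr → ℤExpr → ℤExpr

infixl 6 _⊕_ _⊖_
infixl 7 _⊗_
infix 8 ‵_

⟦_⟧ℤ : ℤExpr → ℤ
⟦ ‵ z ⟧ℤ = z
⟦ a ⊕ b ⟧ℤ = ⟦ a ⟧ℤ ℤ.+ ⟦ b ⟧ℤ
⟦ a ⊗ b ⟧ℤ = ⟦ a ⟧ℤ ℤ.* ⟦ b ⟧ℤ
⟦ a ⊖ b ⟧ℤ = ⟦ a ⟧ℤ ℤ.- ⟦ b ⟧ℤ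

normExpr : ℤ → ℤ → ℤExpr
normExpr f g = ‵ f ⊗ ‵ f ⊕ ‵ g ⊗ ‵ g ⊖ ‵ f ⊗ ‵ g

norm : ℤ → ℤ → ℤ
norm f g = ⟦ normExpr f g ⟧ℤ

aExpr : ℤ → ℤ → ℤ → ℤExpr
aExpr f g l = ‵ (+ 3) ⊗ normExpr f g ⊖ ‵ l ⊗ (‵ f ⊕ ‵ g)

homogenisedExpr : ℤ → ℤ → ℤ → ℤ → ℤExpr
homogenisedExpr a l α β =
  ‵ β ⊗ ‵ β ⊗ ‵ β ⊕ ‵ a ⊗ (‵ β ⊗ ‵ β) ⊗ ‵ α ⊕ ‵ l ⊗ ‵ β ⊗ (‵ α ⊗ ‵ α) ⊖ ‵ α ⊗ (‵ α ⊗ ‵ α)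

module IntegerArithmetic where
  open ℤSolver.+-*-Solver
  open import Data.Integer using (_+_; _*_; _-_; -_)
  open ≡.≡-Reasoning

  CubeRelation : ℤ → ℤ → ℤ → Set
  CubeRelation f g l = f * g * l ≡ f * f * f + (g * g * g + + 1)

  -- the coefficients of the linear polynomial α t − β left after
  -- eliminating between P and the fixed-point quadratic
  αExpr βExpr : ℤ → ℤ → ℤ → ℤExpr
  αExpr f g l = ‵ S ⊗ ‵ S ⊗ ‵ l ⊖ ‵ S ⊕ ‵ S ⊗ ‵ aVal f g l ⊗ (‵ f ⊕ ‵ g) ⊕ (‵ f ⊕ ‵ g) ⊗ (‵ f ⊕ ‵ g)
    where S = norm f g
  βExpr f g l = ‵ S ⊗ ‵ S ⊕ ‵ S ⊗ ‵ aVal f g l ⊕ (‵ f ⊕ ‵ g)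
    where S = norm f g

  unit : ∀ a b → a * b ≡ + 1 → a ≡ + 1 ⊎ a ≡ -[1+ 0 ]
  unit a b ab≡1 with ℕP.m*n≡1⇒m≡1 ℤ.∣ a ∣ ℤ.∣ b ∣ (≡.trans (≡.sym (ℤP.abs-* a b)) (≡.cong ℤ.∣_∣ ab≡1))
  unit (+ .1) b ab≡1 | ≡.refl = inj₁ ≡.refl
  unit -[1+ .0 ] b ab≡1 | ≡.refl = inj₂ ≡.refl

  defect≡0 : ∀ f g l → CubeRelation f g l → f * g * l - (f * f * f + (g * g * g + + 1)) ≡ + 0
  defect≡0 f g l rel = ≡.trans (≡.cong (λ z → z - (f * f * f + (g * g * g + + 1))) rel)
                                     (ℤP.+-inverseʳ (f * f * f + (g * g * g + + 1)))

  -- Since f³ + g³ = (f + g)S, the relation reads f·(gλ) = (f + g)S + 1.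
  sum-of-cubes : ∀ f g l → f * (g * l) ≡ (f * g * l - (f * f * f + (g * g * g + + 1))) + (f + g) * norm f g + + 1
  sum-of-cubes = solve 3 (λ f g l → f :* (g :* l)
    := (f :* g :* l :- (f :* f :* f :+ (g :* g :* g :+ con (+ 1))))
       :+ (f :+ g) :* ((f :* f) :+ (g :* g) :- (f :* g)) :+ con (+ 1)) ≡.refl

  norm-zero⇒unit : ∀ f g l → CubeRelation f g l → norm f g ≡ + 0 → f * (g * l) ≡ + 1
  norm-zero⇒unit f g l rel S≡0 = begin
    f * (g * l)                                                 ≡⟨ sum-of-cubes f g l ⟩
    (f * g * l - (f * f * f + (g * g * g + + 1))) + (f + g) * norm f g + + 1
      ≡⟨ ≡.cong₂ (λ d s → d + (f + g) * s + + 1) (defect≡0 f g l rel) S≡0 ⟩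
    + 0 + (f + g) * + 0 + + 1                                   ≡⟨ ≡.cong (λ z → + 0 + z + + 1) (ℤP.*-zeroʳ (f + g)) ⟩
    + 1                                                         ∎

  -- S = f² + g² − fg is 1 or 3 when f and g are units
  norm-of-units : ∀ f g → f ≡ + 1 ⊎ f ≡ -[1+ 0 ] → g ≡ + 1 ⊎ g ≡ -[1+ 0 ] → ¬ (norm f g ≡ + 0)
  norm-of-units _ _ (inj₁ ≡.refl) (inj₁ ≡.refl) ()
  norm-of-units _ _ (inj₁ ≡.refl) (inj₂ ≡.refl) ()
  norm-of-units _ _ (inj₂ ≡.refl) (inj₁ ≡.refl) ()
  norm-of-units _ _ (inj₂ ≡.refl) (inj₂ ≡.refl) ()

  -- hence S ≠ 0: if S = 0 then f·(gλ) = 1 = g·(fλ), so f and g are units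
  norm≢0 : ∀ f g l → CubeRelation f g l → ¬ (norm f g ≡ + 0)
  norm≢0 f g l rel S≡0 = norm-of-units f g (unit f (g * l) f[gl]≡1) (unit g (f * l) g[fl]≡1) S≡0
    where
    f[gl]≡1 : f * (g * l) ≡ + 1
    f[gl]≡1 = norm-zero⇒unit f g l rel S≡0
    g[fl]≡1 : g * (f * l) ≡ + 1
    g[fl]≡1 = ≡.trans (ℤP.*-comm g (f * l))
                (≡.trans (ℤP.*-assoc f l g) (≡.trans (≡.cong (f *_) (ℤP.*-comm l g)) f[gl]≡1))

  α-identity : ∀ f g l → ⟦ αExpr f g l ⟧ℤ
    ≡ (- + 3) * ((f - g) * (f - g)) + (+ 3 * norm f g) * (f * f * f + (g * g * g + + 1) - f * g * l)
  α-identity = solve 3 (λ f g l →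
    let S = (f :* f) :+ (g :* g) :- (f :* g)
        A = (con (+ 3) :* S) :- (l :* (f :+ g))
    in ((S :* S :* l :- S) :+ (S :* A :* (f :+ g))) :+ ((f :+ g) :* (f :+ g))
       := (:- con (+ 3)) :* ((f :- g) :* (f :- g))
          :+ (con (+ 3) :* S) :* (f :* f :* f :+ (g :* g :* g :+ con (+ 1)) :- f :* g :* l)) ≡.refl

  α≡−3[f−g]² : ∀ f g l → CubeRelation f g l → ⟦ αExpr f g l ⟧ℤ ≡ (- + 3) * ((f - g) * (f - g))
  α≡−3[f−g]² f g l rel = begin
    ⟦ αExpr f g l ⟧ℤ
      ≡⟨ α-identity f g l ⟩
    (- + 3) * ((f - g) * (f - g)) + (+ 3 * norm f g) * (f * f * f + (g * g * g + + 1) - f * g * l)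
      ≡⟨ ≡.cong (λ z → (- + 3) * ((f - g) * (f - g)) + (+ 3 * norm f g) * z) relation≡0 ⟩
    (- + 3) * ((f - g) * (f - g)) + (+ 3 * norm f g) * + 0
      ≡⟨ ≡.cong (λ z → (- + 3) * ((f - g) * (f - g)) + z) (ℤP.*-zeroʳ (+ 3 * norm f g)) ⟩
    (- + 3) * ((f - g) * (f - g)) + + 0
      ≡⟨ ℤP.+-identityʳ ((- + 3) * ((f - g) * (f - g))) ⟩
    (- + 3) * ((f - g) * (f - g))
      ∎
    where
    relation≡0 : f * f * f + (g * g * g + + 1) - f * g * l ≡ + 0
    relation≡0 = ≡.trans (≡.cong (λ z → z - f * g * l) (≡.sym rel)) (ℤP.+-inverseʳ (f * g * l))

  α≢0 : ∀ f g l → CubeRelation f g l → ¬ (f ≡ g) → ¬ (⟦ αExpr f g l ⟧ℤ ≡ + 0)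
  α≢0 f g l rel f≢g α≡0 = [ (λ ()) , square≢0 ]′ (ℤP.i*j≡0⇒i≡0∨j≡0 (- + 3) −3[f−g]²≡0)
    where
    −3[f−g]²≡0 : (- + 3) * ((f - g) * (f - g)) ≡ + 0
    −3[f−g]²≡0 = ≡.trans (≡.sym (α≡−3[f−g]² f g l rel)) α≡0
    difference≢0 : ¬ (f - g ≡ + 0)
    difference≢0 = f≢g ∘ ℤP.i-j≡0⇒i≡j f g
    square≢0 : ¬ ((f - g) * (f - g) ≡ + 0)
    square≢0 sq≡0 = [ difference≢0 , difference≢0 ]′ (ℤP.i*j≡0⇒i≡0∨j≡0 (f - g) sq≡0)

  -- on the diagonal f = g the relation f(fλ − 2f²) = 1 forces (f, λ) = (1, 3) or (−1, −1)
  diagonal-identity : ∀ f l → f * (f * l - f * f - f * f) ≡ (f * f * l - (f * f * f + (f * f * f + + 1))) + + 1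
  diagonal-identity = solve 2 (λ f l → f :* (f :* l :- f :* f :- f :* f)
    := (f :* f :* l :- (f :* f :* f :+ (f :* f :* f :+ con (+ 1)))) :+ con (+ 1)) ≡.refl

  diagonal : ∀ f l → CubeRelation f f l → (f ≡ + 1 × l ≡ + 3) ⊎ (f ≡ -[1+ 0 ] × l ≡ -[1+ 0 ])
  diagonal f l rel
    with unit f (f * l - f * f - f * f) (≡.trans (diagonal-identity f l) (≡.cong (λ z → z + + 1) (defect≡0 f f l rel)))
  ... | inj₁ ≡.refl = inj₁ (≡.refl , ≡.trans (≡.sym (ℤP.*-identityˡ l)) rel)
  ... | inj₂ ≡.refl = inj₂ (≡.refl , ≡.trans (≡.sym (ℤP.*-identityˡ l)) rel)

module InField {c ℓ : Level} (K : Field c ℓ) where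
  open Field K
  open RingProperties ring
    using (-0#≈0#; -‿distribˡ-*; -‿distribʳ-*; -‿involutive; -‿+-comm; x≈y⇒x∙y⁻¹≈ε)
  open SetoidReasoning setoid

  private
    N : ℕ → Carrier
    N = ℕ↦K K

  N-+ : ∀ m n → N (m ℕ.+ n) ≈ N m + N n
  N-+ ℕ.zero n = sym (+-identityˡ _)
  N-+ (ℕ.suc m) n = trans (+-congˡ (N-+ m n)) (sym (+-assoc _ _ _))

  N-* : ∀ m n → N (m ℕ.* n) ≈ N m * N n
  N-* ℕ.zero n = sym (zeroˡ _)
  N-* (ℕ.suc m) n = begin
    N (n ℕ.+ m ℕ.* n)     ≈⟨ N-+ n (m ℕ.* n) ⟩
    N n + N (m ℕ.* n)     ≈⟨ +-cong (sym (*-identityˡ _)) (N-* m n) ⟩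
    1# * N n + N m * N n  ≈⟨ sym (distribʳ _ _ _) ⟩
    (1# + N m) * N n      ∎

  +-cancel-− : ∀ a x y → (a + x) - (a + y) ≈ x - y
  +-cancel-− a x y = begin
    (a + x) + - (a + y)    ≈⟨ +-cong (+-comm a x) (sym (-‿+-comm a y)) ⟩
    (x + a) + (- a + - y)  ≈⟨ +-assoc _ _ _ ⟩
    x + (a + (- a + - y))  ≈⟨ +-congˡ (sym (+-assoc _ _ _)) ⟩
    x + ((a - a) + - y)    ≈⟨ +-congˡ (+-congʳ (-‿inverseʳ a)) ⟩
    x + (0# + - y)         ≈⟨ +-congˡ (+-identityˡ _) ⟩
    x - y                  ∎

  ι-⊖ : ∀ m n → ι K (m ℤ.⊖ n) ≈ N m - N n
  ι-⊖ ℕ.zero ℕ.zero = sym (-‿inverseʳ 0#)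
  ι-⊖ ℕ.zero (ℕ.suc n) = sym (+-identityˡ _)
  ι-⊖ (ℕ.suc m) ℕ.zero = sym (trans (+-congˡ -0#≈0#) (+-identityʳ _))
  ι-⊖ (ℕ.suc m) (ℕ.suc n) = begin
    ι K (ℕ.suc m ℤ.⊖ ℕ.suc n)  ≡⟨ ≡.cong (ι K) (ℤP.[1+m]⊖[1+n]≡m⊖n m n) ⟩
    ι K (m ℤ.⊖ n)              ≈⟨ ι-⊖ m n ⟩
    N m - N n                  ≈⟨ sym (+-cancel-− 1# (N m) (N n)) ⟩
    N (ℕ.suc m) - N (ℕ.suc n)  ∎

  ι-+ : ∀ i j → ι K (i ℤ.+ j) ≈ ι K i + ι K j
  ι-+ (+ m) (+ n) = N-+ m n
  ι-+ (+ m) -[1+ n ] = ι-⊖ m (ℕ.suc n)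
  ι-+ -[1+ m ] (+ n) = trans (ι-⊖ n (ℕ.suc m)) (+-comm _ _)
  ι-+ -[1+ m ] -[1+ n ] = begin
    - (1# + (1# + N (m ℕ.+ n)))    ≡⟨ ≡.cong (λ k → - (1# + N k)) (≡.sym (ℕP.+-suc m n)) ⟩
    - N (ℕ.suc m ℕ.+ ℕ.suc n)      ≈⟨ -‿cong (N-+ (ℕ.suc m) (ℕ.suc n)) ⟩
    - (N (ℕ.suc m) + N (ℕ.suc n))  ≈⟨ sym (-‿+-comm _ _) ⟩
    - N (ℕ.suc m) - N (ℕ.suc n)    ∎

  ι-neg : ∀ i → ι K (ℤ.- i) ≈ - ι K i
  ι-neg (+ ℕ.zero) = sym -0#≈0#
  ι-neg (+ ℕ.suc n) = refl
  ι-neg -[1+ n ] = sym (-‿involutive _)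

  ι-− : ∀ i j → ι K (i ℤ.- j) ≈ ι K i - ι K j
  ι-− i j = trans (ι-+ i (ℤ.- j)) (+-congˡ (ι-neg j))

  ι-+◃ : ∀ n → ι K (Sign.+ ℤ.◃ n) ≈ N n
  ι-+◃ ℕ.zero = refl
  ι-+◃ (ℕ.suc n) = refl

  ι--◃ : ∀ n → ι K (Sign.- ℤ.◃ n) ≈ - N n
  ι--◃ ℕ.zero = sym -0#≈0#
  ι--◃ (ℕ.suc n) = refl

  -‿*-‿ : ∀ x y → (- x) * (- y) ≈ x * y
  -‿*-‿ x y = begin
    (- x) * (- y)  ≈⟨ sym (-‿distribˡ-* x (- y)) ⟩
    - (x * - y)    ≈⟨ -‿cong (sym (-‿distribʳ-* x y)) ⟩
    - - (x * y)    ≈⟨ -‿involutive _ ⟩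
    x * y          ∎

  ι-* : ∀ i j → ι K (i ℤ.* j) ≈ ι K i * ι K j
  ι-* (+ m) (+ n) = trans (ι-+◃ (m ℕ.* n)) (N-* m n)
  ι-* (+ m) -[1+ n ] = begin
    ι K (Sign.- ℤ.◃ (m ℕ.* ℕ.suc n))  ≈⟨ ι--◃ (m ℕ.* ℕ.suc n) ⟩
    - N (m ℕ.* ℕ.suc n)               ≈⟨ -‿cong (N-* m (ℕ.suc n)) ⟩
    - (N m * N (ℕ.suc n))             ≈⟨ -‿distribʳ-* _ _ ⟩
    N m * - N (ℕ.suc n)               ∎
  ι-* -[1+ m ] (+ n) = begin
    ι K (Sign.- ℤ.◃ (ℕ.suc m ℕ.* n))  ≈⟨ ι--◃ (ℕ.suc m ℕ.* n) ⟩
    - N (ℕ.suc m ℕ.* n)               ≈⟨ -‿cong (N-* (ℕ.suc m) n) ⟩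
    - (N (ℕ.suc m) * N n)             ≈⟨ -‿distribˡ-* _ _ ⟩
    - N (ℕ.suc m) * N n               ∎
  ι-* -[1+ m ] -[1+ n ] = begin
    ι K (Sign.+ ℤ.◃ (ℕ.suc m ℕ.* ℕ.suc n))  ≈⟨ ι-+◃ (ℕ.suc m ℕ.* ℕ.suc n) ⟩
    N (ℕ.suc m ℕ.* ℕ.suc n)                 ≈⟨ N-* (ℕ.suc m) (ℕ.suc n) ⟩
    N (ℕ.suc m) * N (ℕ.suc n)               ≈⟨ sym (-‿*-‿ _ _) ⟩
    - N (ℕ.suc m) * - N (ℕ.suc n)           ∎

  -- Its constants are
  -- read through ι₁, which agrees with ι but sends +1 to 1# on the nose,
  -- so that the constant 1 of a solved identity is literally 1#.
  ι₁ : ℤ → Carrier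
  ι₁ (+ 1) = 1#
  ι₁ z = ι K z

  ι₁≈ι : ∀ z → ι₁ z ≈ ι K z
  ι₁≈ι (+ ℕ.zero) = refl
  ι₁≈ι (+ 1) = sym (+-identityʳ _)
  ι₁≈ι (+ ℕ.suc (ℕ.suc n)) = refl
  ι₁≈ι -[1+ n ] = refl

  ι₁-morphism : CommutativeRing.rawRing ℤP.+-*-commutativeRing
                  ACR.-Raw-AlmostCommutative⟶ ACR.fromCommutativeRing commutativeRing
  ι₁-morphism = record
    { ⟦_⟧    = ι₁
    ; +-homo = λ i j → homo₂ (ι-+ i j) (ι₁≈ι (i ℤ.+ j)) (+-cong (ι₁≈ι i) (ι₁≈ι j))
    ; *-homo = λ i j → homo₂ (ι-* i j) (ι₁≈ι (i ℤ.* j)) (*-cong (ι₁≈ι i) (ι₁≈ι j))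
    ; -‿homo = λ i → homo₂ (ι-neg i) (ι₁≈ι (ℤ.- i)) (-‿cong (ι₁≈ι i))
    ; 0-homo = refl
    ; 1-homo = refl
    }
    where
    homo₂ : ∀ {x y x′ y′} → x ≈ y → x′ ≈ x → y′ ≈ y → x′ ≈ y′
    homo₂ x≈y x′≈x y′≈y = trans x′≈x (trans x≈y (sym y′≈y))

  ι₁-equal? : ∀ i j → Maybe (ι₁ i ≈ ι₁ j)
  ι₁-equal? i j with i ℤ.≟ j
  ... | yes ≡.refl = just refl
  ... | no _ = nothing

  open RingSolver (CommutativeRing.rawRing ℤP.+-*-commutativeRing)
                  (ACR.fromCommutativeRing commutativeRing) ι₁-morphism ι₁-equal?
    public using (solve; _:+_; _:*_; _:-_; :-_; con; _:=_)

  ⟦_⟧K : ℤExpr → Carrier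
  ⟦ ‵ z ⟧K = ι K z
  ⟦ a ⊕ b ⟧K = ⟦ a ⟧K + ⟦ b ⟧K
  ⟦ a ⊗ b ⟧K = ⟦ a ⟧K * ⟦ b ⟧K
  ⟦ a ⊖ b ⟧K = ⟦ a ⟧K - ⟦ b ⟧K

  ι-⟦⟧ : ∀ e → ι K ⟦ e ⟧ℤ ≈ ⟦ e ⟧K
  ι-⟦⟧ (‵ z) = refl
  ι-⟦⟧ (a ⊕ b) = trans (ι-+ ⟦ a ⟧ℤ ⟦ b ⟧ℤ) (+-cong (ι-⟦⟧ a) (ι-⟦⟧ b))
  ι-⟦⟧ (a ⊗ b) = trans (ι-* ⟦ a ⟧ℤ ⟦ b ⟧ℤ) (*-cong (ι-⟦⟧ a) (ι-⟦⟧ b))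
  ι-⟦⟧ (a ⊖ b) = trans (ι-− ⟦ a ⟧ℤ ⟦ b ⟧ℤ) (+-cong (ι-⟦⟧ a) (-‿cong (ι-⟦⟧ b)))


  cancel : ∀ {x z} → ¬ (x ≈ 0#) → x * z ≈ 0# → z ≈ 0#
  cancel {x} {z} x≉0 xz≈0 with inverse x x≉0
  ... | (y , xy≈1) = begin
    z            ≈⟨ sym (*-identityˡ z) ⟩
    1# * z       ≈⟨ *-congʳ (sym xy≈1) ⟩
    (x * y) * z  ≈⟨ *-congʳ (*-comm x y) ⟩
    (y * x) * z  ≈⟨ *-assoc y x z ⟩
    y * (x * z)  ≈⟨ *-congˡ xz≈0 ⟩
    y * 0#       ≈⟨ zeroʳ y ⟩
    0#           ∎

  cancel³ : ∀ {x z} → ¬ (x ≈ 0#) → x * (x * (x * z)) ≈ 0# → z ≈ 0#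
  cancel³ x≉0 = cancel x≉0 ∘ cancel x≉0 ∘ cancel x≉0

  vanish³ : ∀ {x z} → z ≈ 0# → x * (x * (x * z)) ≈ 0#
  vanish³ {x} z≈0 = zero-factor (zero-factor (zero-factor z≈0))
    where
    zero-factor : ∀ {w} → w ≈ 0# → x * w ≈ 0#
    zero-factor w≈0 = trans (*-congˡ w≈0) (zeroʳ x)

  combination≈0 : ∀ {a p b q} → p ≈ 0# → q ≈ 0# → a * p + b * q ≈ 0#
  combination≈0 {a} {p} {b} {q} p≈0 q≈0 = begin
    a * p + b * q    ≈⟨ +-cong (*-congˡ p≈0) (*-congˡ q≈0) ⟩
    a * 0# + b * 0#  ≈⟨ +-cong (zeroʳ a) (zeroʳ b) ⟩
    0# + 0#          ≈⟨ +-identityʳ 0# ⟩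
    0#               ∎

  cubic : Carrier → Carrier → Carrier → Carrier
  cubic A L y = (y * y * y) + (A * (y * y)) + (L * y) - 1#

  cubic-cong : ∀ {A A′} L y → A ≈ A′ → cubic A L y ≈ cubic A′ L y
  cubic-cong L y A≈A′ = +-congʳ (+-congʳ (+-congˡ (*-congʳ A≈A′)))

  -- Its homogenisation H(d, u) = d³ P(u/d), written without division.
  homogenised : Carrier → Carrier → Carrier → Carrier → Carrier
  homogenised A L d u = u * u * u + A * (u * u) * d + L * u * (d * d) - d * (d * d)

  homogenised-cong : ∀ {A A′ L d d′ u u′} → A ≈ A′ → d ≈ d′ → u ≈ u′ →
                     homogenised A L d u ≈ homogenised A′ L d′ u′
  homogenised-cong A≈ d≈ u≈ =
    +-cong (+-cong (+-cong (*-cong (*-cong u≈ u≈) u≈) (*-cong (*-cong A≈ (*-cong u≈ u≈)) d≈))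
                   (*-cong (*-congˡ u≈) (*-cong d≈ d≈)))
           (-‿cong (*-cong d≈ (*-cong d≈ d≈)))

  homogenised-at : ∀ A L d y u → d * y ≈ u → homogenised A L d u ≈ d * (d * (d * cubic A L y))
  homogenised-at A L d y u dy≈u = begin
    homogenised A L d u        ≈⟨ homogenised-cong refl refl (sym dy≈u) ⟩
    homogenised A L d (d * y)  ≈⟨ expand A L d y ⟩
    d * (d * (d * cubic A L y)) ∎
    where
    expand : ∀ A L d y → homogenised A L d (d * y) ≈ d * (d * (d * cubic A L y))
    expand = solve 4 (λ A L d y →
      (d :* y) :* (d :* y) :* (d :* y) :+ A :* ((d :* y) :* (d :* y)) :* d
        :+ L :* (d :* y) :* (d :* d) :- d :* (d :* d)
      := d :* (d :* (d :* ((y :* y :* y) :+ (A :* (y :* y)) :+ (L :* y) :- con (+ 1))))) refl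

  normK : Carrier → Carrier → Carrier
  normK F G = F * F + G * G - F * G

  aK : Carrier → Carrier → Carrier → Carrier
  aK F G Λ = ι K (+ 3) * normK F G - Λ * (F + G)

  defectK : Carrier → Carrier → Carrier → Carrier
  defectK F G Λ = F * G * Λ - (F * F * F + (G * G * G + 1#))

  root-certificate : ∀ F G Λ t →
    homogenised (aK F G Λ) Λ (normK F G * t - G) (F * t - 1#)
    ≈ (G - F) * ((G - F) * (G - F)) * cubic (aK F G Λ) Λ t
      + ((1# - F * t) * ((1# - F * t) * (1# - F * t)) + (G - F) * ((G - F) * (G - F)) * (t * (t * t)))
        * defectK F G Λ
  root-certificate = solve 4 (λ F G Λ t →
    let S = F :* F :+ G :* G :- F :* G
        A = con (+ 3) :* S :- Λ :* (F :+ G)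
        d = S :* t :- G
        u = F :* t :- con (+ 1)
        one = con (+ 1)
        δ = G :- F
    in u :* u :* u :+ A :* (u :* u) :* d :+ Λ :* u :* (d :* d) :- d :* (d :* d)
       := δ :* (δ :* δ) :* ((t :* t :* t) :+ (A :* (t :* t)) :+ (Λ :* t) :- one)
          :+ ((one :- F :* t) :* ((one :- F :* t) :* (one :- F :* t)) :+ δ :* (δ :* δ) :* (t :* (t :* t)))
             :* (F :* G :* Λ :- (F :* F :* F :+ (G :* G :* G :+ one)))) refl

  -- Fixed points: eliminating t² and t³ between P(t) and the quadratic
  -- Q(t) = (St − G)t − (Ft − 1) leaves a linear polynomial α t − β.
  fixed-point-certificate : ∀ S A Λ F G t →
    (S * S * Λ - S + S * A * (F + G) + (F + G) * (F + G)) * t - (S * S + S * A + (F + G))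
    ≈ S * S * cubic A Λ t + (- (S * t + S * A + (F + G))) * ((S * t - G) * t - (F * t - 1#))
  fixed-point-certificate = solve 6 (λ S A Λ F G t →
    (S :* S :* Λ :- S :+ S :* A :* (F :+ G) :+ (F :+ G) :* (F :+ G)) :* t :- (S :* S :+ S :* A :+ (F :+ G))
    := S :* S :* ((t :* t :* t) :+ (A :* (t :* t)) :+ (Λ :* t) :- con (+ 1))
       :+ (:- (S :* t :+ S :* A :+ (F :+ G))) :* ((S :* t :- G) :* t :- (F :* t :- con (+ 1)))) refl

  ι-norm : ∀ f g → ι K (norm f g) ≈ normK (ι K f) (ι K g)
  ι-norm f g = ι-⟦⟧ (normExpr f g)

  ι-aVal : ∀ f g l → ι K (aVal f g l) ≈ aK (ι K f) (ι K g) (ι K l)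
  ι-aVal f g l = ι-⟦⟧ (aExpr f g l)

  ι-defect : ∀ f g l → IntegerArithmetic.CubeRelation f g l → defectK (ι K f) (ι K g) (ι K l) ≈ 0#
  ι-defect f g l rel = x≈y⇒x∙y⁻¹≈ε (begin
    ι K f * ι K g * ι K l
      ≈⟨ sym (ι-⟦⟧ (‵ f ⊗ ‵ g ⊗ ‵ l)) ⟩
    ι K (f ℤ.* g ℤ.* l)
      ≡⟨ ≡.cong (ι K) rel ⟩
    ι K (f ℤ.* f ℤ.* f ℤ.+ (g ℤ.* g ℤ.* g ℤ.+ + 1))
      ≈⟨ ι-⟦⟧ (‵ f ⊗ ‵ f ⊗ ‵ f ⊕ (‵ g ⊗ ‵ g ⊗ ‵ g ⊕ ‵ (+ 1))) ⟩
    ι K f * ι K f * ι K f + (ι K g * ι K g * ι K g + (1# + 0#))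
      ≈⟨ +-congˡ (+-congˡ (+-identityʳ 1#)) ⟩
    ι K f * ι K f * ι K f + (ι K g * ι K g * ι K g + 1#)
      ∎)

  homogenised-descent : ∀ a l α β t → ι K α * t ≈ ι K β →
    ι K ⟦ homogenisedExpr a l α β ⟧ℤ ≈ ι K α * (ι K α * (ι K α * cubic (ι K a) (ι K l) t))
  homogenised-descent a l α β t αt≈β =
    trans (ι-⟦⟧ (homogenisedExpr a l α β)) (homogenised-at (ι K a) (ι K l) (ι K α) t (ι K β) αt≈β)

module Rationals where
  open import Data.Rational using (_+_; _*_; -_; 0ℚ; 1ℚ)

  ℚ-field : Field _ _
  ℚ-field = record
    { commutativeRing = ℚP.+-*-commutativeRing
    ; 1≉0 = λ ()
    ; inverse = λ x x≢0 → ℚ.1/_ x {{ℚ.≢-nonZero x≢0}} , ℚP.*-inverseʳ x {{ℚ.≢-nonZero x≢0}}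
    }

  open InField ℚ-field using (solve; _:+_; _:*_; _:-_; :-_; con; _:=_; cubic)

  ι-ℚ : ∀ z → ι ℚ-field z ≡ toℚ z
  ι-ℚ (+ n) = ι-ℕ n
    where
    toℚ-suc : ∀ n → 1ℚ + toℚ (+ n) ≡ toℚ (+ ℕ.suc n)
    toℚ-suc n rewrite ℚP.normalize-coprime {n} {0} (Coprime.sym (Coprime.1-coprimeTo n)) =
      ≡.cong toℚ (≡.cong (λ k → (+ 1) ℤ.+ k) (ℤP.*-identityʳ (+ n)))
    ι-ℕ : ∀ n → ℕ↦K ℚ-field n ≡ toℚ (+ n)
    ι-ℕ ℕ.zero = ≡.refl
    ι-ℕ (ℕ.suc n) = ≡.trans (≡.cong (λ q → 1ℚ + q) (ι-ℕ n)) (toℚ-suc n)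
  ι-ℚ -[1+ n ] = ≡.cong -_ (ι-ℚ (+ ℕ.suc n))

  ℚ-charZero : CharZero ℚ-field
  ℚ-charZero z ιz≡0 = ≡.sym (≡.subst (λ q → ℚ.↥ q ℤ.* ℤGCD.gcd z (+ 1) ≡ z) toℚz≡0 (ℚP.↥-/ z 1))
    where
    toℚz≡0 : toℚ z ≡ 0ℚ
    toℚz≡0 = ≡.trans (≡.sym (ι-ℚ z)) ιz≡0

  -- Coefficientwise, (X − r)(X² + q₁X + q₀) = X³ + c₂X² + c₁X + c₀ for
  -- q₁ = c₂ + r and q₀ = c₁ + r q₁, provided c₀ + r q₀ = 0, i.e. r is a root.
  constant-coefficient : ∀ c₀ r q₀ → c₀ ≡ (- r) * q₀ + (c₀ + r * q₀)
  constant-coefficient = solve 3 (λ c₀ r q₀ → c₀ := (:- r) :* q₀ :+ (c₀ :+ r :* q₀)) ≡.refl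

  linear-coefficient : ∀ c₁ r q₁ → c₁ ≡ (- r) * q₁ + (1ℚ * (c₁ + r * q₁) + 0ℚ)
  linear-coefficient = solve 3 (λ c₁ r q₁ →
    c₁ := (:- r) :* q₁ :+ (con (+ 1) :* (c₁ :+ r :* q₁) :+ con (+ 0))) ≡.refl

  quadratic-coefficient : ∀ c₂ r → c₂ ≡ (- r) * 1ℚ + 1ℚ * (c₂ + r)
  quadratic-coefficient = solve 2 (λ c₂ r →
    c₂ := (:- r) :* con (+ 1) :+ con (+ 1) :* (c₂ :+ r)) ≡.refl

  factor-root : ∀ c₀ c₁ c₂ r → c₀ + r * (c₁ + r * (c₂ + r)) ≡ 0ℚ →
    c₀ ∷ c₁ ∷ c₂ ∷ 1ℚ ∷ [] ≡ ℚ[X]._*ₚ_ ((- r) ∷ 1ℚ ∷ []) ((c₁ + r * (c₂ + r)) ∷ (c₂ + r) ∷ 1ℚ ∷ [])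
  factor-root c₀ c₁ c₂ r root =
    ≡.cong₂ _∷_ (≡.trans (constant-coefficient c₀ r (c₁ + r * (c₂ + r)))
                         (≡.cong (λ z → (- r) * (c₁ + r * (c₂ + r)) + z) root))
      (≡.cong₂ _∷_ (linear-coefficient c₁ r (c₂ + r))
        (≡.cong₂ _∷_ (quadratic-coefficient c₂ r) ≡.refl))

  cubic-with-root-reducible : ∀ c₀ c₁ c₂ r → c₀ + r * (c₁ + r * (c₂ + r)) ≡ 0ℚ →
                              ¬ ℚ[X].Irreducible (c₀ ∷ c₁ ∷ c₂ ∷ 1ℚ ∷ [])
  cubic-with-root-reducible c₀ c₁ c₂ r root (_ , _ , factors-trivially) =
    [ (λ ()) , (λ ()) ]′ (factors-trivially ((- r) ∷ 1ℚ ∷ []) ((c₁ + r * (c₂ + r)) ∷ (c₂ + r) ∷ 1ℚ ∷ [])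
                                            (≡.cong ℚ[X].trim (factor-root c₀ c₁ c₂ r root)))

  horner : ∀ A L r → - 1ℚ + r * (L + r * (A + r)) ≡ cubic A L r
  horner = solve 3 (λ A L r →
    :- con (+ 1) :+ r :* (L :+ r :* (A :+ r))
    := (r :* r :* r) :+ (A :* (r :* r)) :+ (L :* r) :- con (+ 1)) ≡.refl

  Pℚ-root-reducible : ∀ f g l r → P-at ℚ-field f g l r ≡ 0ℚ → ¬ ℚ[X].Irreducible (Pℚ f g l)
  Pℚ-root-reducible f g l r root =
    cubic-with-root-reducible _ _ _ r (≡.trans (horner (toℚ (aVal f g l)) (toℚ l) r) root′)
    where
    root′ : cubic (toℚ (aVal f g l)) (toℚ l) r ≡ 0ℚ
    root′ = ≡.subst₂ (λ A L → cubic A L r ≡ 0ℚ) (ι-ℚ (aVal f g l)) (ι-ℚ l) root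

-- Rational root descent: if a root θ of P in a field K of characteristic
-- zero satisfies αθ = β for integers α ≠ 0 and β, then β/α is a rational
-- root of P.  Indeed the integer H(α, β) equals α³P(θ) = 0 in K, so it is 0
-- by characteristic zero, and then α³P(β/α) = H(α, β) = 0 in ℚ.
rational-root-descent : ∀ {c ℓ} (K : Field c ℓ) → CharZero K →
  ∀ f g l (α β : ℤ) θ → ¬ (α ≡ + 0) → Field._≈_ K (Field._*_ K (ι K α) θ) (ι K β) →
  Field._≈_ K (P-at K f g l θ) (Field.0# K) → ¬ ℚ[X].Irreducible (Pℚ f g l)
rational-root-descent K charZero f g l α β θ α≢0 αθ≈β root =
  Rationals.Pℚ-root-reducible f g l r (inℚ.cancel³ ια≢0 α³P[r]≡0)
  where
  open Rationals using (ℚ-field; ℚ-charZero)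
  module inK = InField K
  module inℚ = InField ℚ-field
  H≡0 : ⟦ homogenisedExpr (aVal f g l) l α β ⟧ℤ ≡ + 0
  H≡0 = charZero _ (Field.trans K (inK.homogenised-descent (aVal f g l) l α β θ αθ≈β) (inK.vanish³ root))
  ια≢0 : ¬ (ι ℚ-field α ≡ ℚ.0ℚ)
  ια≢0 = α≢0 ∘ ℚ-charZero α
  open Σ (Field.inverse ℚ-field (ι ℚ-field α) ια≢0) renaming (proj₁ to α⁻¹; proj₂ to αα⁻¹≡1)
  r : ℚ
  r = α⁻¹ ℚ.* ι ℚ-field β
  αr≡β : ι ℚ-field α ℚ.* r ≡ ι ℚ-field β
  αr≡β = ≡.trans (≡.sym (ℚP.*-assoc (ι ℚ-field α) α⁻¹ (ι ℚ-field β)))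
           (≡.trans (≡.cong (ℚ._* ι ℚ-field β) αα⁻¹≡1)
                    (ℚP.*-identityˡ (ι ℚ-field β)))
  α³P[r]≡0 : ι ℚ-field α ℚ.* (ι ℚ-field α ℚ.* (ι ℚ-field α ℚ.* P-at ℚ-field f g l r)) ≡ ℚ.0ℚ
  α³P[r]≡0 = ≡.trans (≡.sym (inℚ.homogenised-descent (aVal f g l) l α β r αr≡β)) (≡.cong (ι ℚ-field) H≡0)

-- On the diagonal f = g the cubic has the rational root 1: it is (X − 1)³
-- for (f, λ) = (1, 3) and (X − 1)(X + 1)² for (f, λ) = (−1, −1).
diagonal-reducible : ∀ f g l → f ≡ g → IntegerArithmetic.CubeRelation f g l → ¬ ℚ[X].Irreducible (Pℚ f g l)
diagonal-reducible f .f l ≡.refl rel with IntegerArithmetic.diagonal f l rel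
... | inj₁ (≡.refl , ≡.refl) = Rationals.Pℚ-root-reducible (+ 1) (+ 1) (+ 3) ℚ.1ℚ ≡.refl
... | inj₂ (≡.refl , ≡.refl) = Rationals.Pℚ-root-reducible -[1+ 0 ] -[1+ 0 ] -[1+ 0 ] ℚ.1ℚ ≡.refl

-- Evaluation at n is a ring homomorphism ℤ[X] → ℤ, so the polynomial
-- identity fgλ = f³ + g³ + 1 gives the integer relation at every n.
module Evaluation where
  open ℤ[X]
  open ℤSolver.+-*-Solver
  open import Data.Integer using (_+_; _*_)
  open IntegerArithmetic using (CubeRelation)

  eval-cons' : ∀ a p x → eval (cons' a p) x ≡ eval (a ∷ p) x
  eval-cons' a [] x with a ℤP.≟ + 0
  ... | yes ≡.refl = ≡.sym (≡.trans (ℤP.+-identityˡ _) (ℤP.*-zeroʳ x))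
  ... | no _ = ≡.refl
  eval-cons' a (b ∷ bs) x = ≡.refl

  eval-trim : ∀ p x → eval (trim p) x ≡ eval p x
  eval-trim [] x = ≡.refl
  eval-trim (a ∷ p) x = ≡.trans (eval-cons' a (trim p) x) (≡.cong (λ z → a + x * z) (eval-trim p x))

  eval-≈ₚ : ∀ p q x → p ≈ₚ q → eval p x ≡ eval q x
  eval-≈ₚ p q x p≈q = ≡.trans (≡.sym (eval-trim p x)) (≡.trans (≡.cong (λ r → eval r x) p≈q) (eval-trim q x))

  eval-+ : ∀ p q x → eval (p +ₚ q) x ≡ eval p x + eval q x
  eval-+ [] q x = ≡.sym (ℤP.+-identityˡ _)
  eval-+ (a ∷ p) [] x = ≡.sym (ℤP.+-identityʳ _)
  eval-+ (a ∷ p) (b ∷ q) x rewrite eval-+ p q x =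
    solve 5 (λ a b x u w → (a :+ b) :+ x :* (u :+ w) := (a :+ x :* u) :+ (b :+ x :* w)) ≡.refl
      a b x (eval p x) (eval q x)

  eval-scale : ∀ c p x → eval (scale c p) x ≡ c * eval p x
  eval-scale c [] x = ≡.sym (ℤP.*-zeroʳ c)
  eval-scale c (a ∷ p) x rewrite eval-scale c p x =
    solve 4 (λ c a x u → c :* a :+ x :* (c :* u) := c :* (a :+ x :* u)) ≡.refl c a x (eval p x)

  eval-* : ∀ p q x → eval (p *ₚ q) x ≡ eval p x * eval q x
  eval-* [] q x = ≡.refl
  eval-* (a ∷ p) q x rewrite eval-+ (scale a q) (+ 0 ∷ (p *ₚ q)) x | eval-scale a q x | eval-* p q x =
    solve 4 (λ a x u w → a :* w :+ (con (+ 0) :+ x :* (u :* w)) := (a :+ x :* u) :* w) ≡.refl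
      a x (eval p x) (eval q x)

  eval-cube : ∀ p x → eval (p *ₚ p *ₚ p) x ≡ eval p x * eval p x * eval p x
  eval-cube p x = ≡.trans (eval-* (p *ₚ p) p x) (≡.cong (_* eval p x) (eval-* p p x))

  eval-relation : ∀ f g lam n → (f *ₚ g) *ₚ lam ≈ₚ cubeSum f g →
                  CubeRelation (eval f n) (eval g n) (eval lam n)
  eval-relation f g lam n identity = begin
    eval f n * eval g n * eval lam n
      ≡⟨ ≡.sym (≡.trans (eval-* (f *ₚ g) lam n) (≡.cong (_* eval lam n) (eval-* f g n))) ⟩
    eval ((f *ₚ g) *ₚ lam) n
      ≡⟨ eval-≈ₚ ((f *ₚ g) *ₚ lam) (cubeSum f g) n identity ⟩
    eval (cubeSum f g) n
      ≡⟨ eval-+ (f *ₚ f *ₚ f) _ n ⟩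
    eval (f *ₚ f *ₚ f) n + eval ((g *ₚ g *ₚ g) +ₚ (+ 1 ∷ [])) n
      ≡⟨ ≡.cong₂ _+_ (eval-cube f n) (eval-+ (g *ₚ g *ₚ g) _ n) ⟩
    eval f n * eval f n * eval f n + (eval (g *ₚ g *ₚ g) n + (+ 1 + n * + 0))
      ≡⟨ ≡.cong₂ (λ a b → eval f n * eval f n * eval f n + (a + b))
                 (eval-cube g n) (≡.cong (λ z → + 1 + z) (ℤP.*-zeroʳ n)) ⟩
    eval f n * eval f n * eval f n + (eval g n * eval g n * eval g n + + 1)
      ∎
    where open ≡.≡-Reasoning

module AtValues {c ℓ : Level} (K : Field c ℓ) (charZero : CharZero K)
                (f g l : ℤ) (relation : IntegerArithmetic.CubeRelation f g l)
                (irreducible : ℚ[X].Irreducible (Pℚ f g l))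
                (θ : Field.Carrier K) (root : Field._≈_ K (P-at K f g l θ) (Field.0# K)) where
  open Field K
  open InField K
  open IntegerArithmetic using (norm≢0; αExpr; βExpr; α≢0)
  open RingProperties ring using (x∙y⁻¹≈ε⇒x≈y; x≈y⇒x∙y⁻¹≈ε)
  open SetoidReasoning setoid

  F G Λ S A : Carrier
  F = ι K f
  G = ι K g
  Λ = ι K l
  S = ι K (norm f g)
  A = ι K (aVal f g l)

  -- G(θ) = num / den
  den num : Carrier
  den = S * θ - G
  num = F * θ - 1#

  -- θ is irrational, so Sθ ≠ g (as S ≠ 0)
  den≉0 : ¬ (den ≈ 0#)
  den≉0 den≈0 = rational-root-descent K charZero f g l (norm f g) g θ (norm≢0 f g l relation)
                  (x∙y⁻¹≈ε⇒x≈y (S * θ) G den≈0) root irreducible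

  -- G(θ) is a root: den³ P(G(θ)) = H(den, num) = 0 by the root certificate
  image-is-root : ∀ y → den * y ≈ num → P-at K f g l y ≈ 0#
  image-is-root y den·y≈num = cancel³ den≉0 (begin
    den * (den * (den * P-at K f g l y))
      ≈⟨ sym (homogenised-at A Λ den y num den·y≈num) ⟩
    homogenised A Λ den num
      ≈⟨ homogenised-cong (ι-aVal f g l) (+-congʳ (*-congʳ (ι-norm f g))) refl ⟩
    homogenised (aK F G Λ) Λ (normK F G * θ - G) num
      ≈⟨ root-certificate F G Λ θ ⟩
    (G - F) * ((G - F) * (G - F)) * cubic (aK F G Λ) Λ θ
      + ((1# - F * θ) * ((1# - F * θ) * (1# - F * θ)) + (G - F) * ((G - F) * (G - F)) * (θ * (θ * θ)))
        * defectK F G Λ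
      ≈⟨ combination≈0 (trans (cubic-cong Λ θ (sym (ι-aVal f g l))) root) (ι-defect f g l relation) ⟩
    0#
      ∎)

  -- G(θ) ≠ θ: a fixed point would be a common root of P and the quadratic
  -- den·t − num, hence (f ≠ g) a root of the linear α t − β with α ≠ 0,
  -- or (f = g) P would have the rational root 1; both contradict irreducibility.
  image-differs : ∀ y → den * y ≈ num → ¬ (y ≈ θ)
  image-differs y den·y≈num y≈θ with f ℤ.≟ g
  ... | yes f≡g = diagonal-reducible f g l f≡g relation irreducible
  ... | no f≢g = rational-root-descent K charZero f g l ⟦ αExpr f g l ⟧ℤ ⟦ βExpr f g l ⟧ℤ θ
                   (α≢0 f g l relation f≢g) αθ≈β root irreducible
    where
    quadratic≈0 : den * θ - num ≈ 0#
    quadratic≈0 = x≈y⇒x∙y⁻¹≈ε (trans (*-congˡ (sym y≈θ)) den·y≈num)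
    αθ≈β : ι K ⟦ αExpr f g l ⟧ℤ * θ ≈ ι K ⟦ βExpr f g l ⟧ℤ
    αθ≈β = begin
      ι K ⟦ αExpr f g l ⟧ℤ * θ
        ≈⟨ *-congʳ (ι-⟦⟧ (αExpr f g l)) ⟩
      ⟦ αExpr f g l ⟧K * θ
        ≈⟨ x∙y⁻¹≈ε⇒x≈y _ _ (trans (fixed-point-certificate S A Λ F G θ) (combination≈0 root quadratic≈0)) ⟩
      ⟦ βExpr f g l ⟧K
        ≈⟨ sym (ι-⟦⟧ (βExpr f g l)) ⟩
      ι K ⟦ βExpr f g l ⟧ℤ
        ∎

-- Main theorem.
mainTheorem1 : (f g lam : ℤ[X].Poly) →
    ℤ[X].NonZeroPoly f → ℤ[X].NonZeroPoly g →
    ℤ[X].deg f < ℤ[X].deg g →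
    ℤ[X]._≈ₚ_ (ℤ[X]._*ₚ_ (ℤ[X]._*ₚ_ f g) lam) (cubeSum f g) →
    (n : ℤ) →
    ℚ[X].Irreducible (Pℚ (ℤ[X].eval f n) (ℤ[X].eval g n) (ℤ[X].eval lam n)) →
    ∀ {c ℓ : Level} (K : Field c ℓ) → CharZero K →
    (θ : Field.Carrier K) →
    Field._≈_ K (P-at K (ℤ[X].eval f n) (ℤ[X].eval g n) (ℤ[X].eval lam n) θ) (Field.0# K) →
    let fn = ℤ[X].eval f n
        gn = ℤ[X].eval g n
        ln = ℤ[X].eval lam n
        open Field K
        den = (ι K ((fn ℤ.* fn) ℤ.+ (gn ℤ.* gn) ℤ.- (fn ℤ.* gn)) * θ) - ι K gn
        num = (ι K fn * θ) - 1#
    in ¬ (den ≈ 0#) ×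
       (∀ y → (den * y) ≈ num → (P-at K fn gn ln y ≈ 0#) × ¬ (y ≈ θ))
mainTheorem1 f g lam _ _ _ identity n irreducible K charZero θ root =
  den≉0 , λ y den·y≈num → image-is-root y den·y≈num , image-differs y den·y≈num
  where
  open AtValues K charZero (ℤ[X].eval f n) (ℤ[X].eval g n) (ℤ[X].eval lam n)
                (Evaluation.eval-relation f g lam n identity) irreducible θ root
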